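{- Let $k\ge 2$ and $n=2k+1$. The map $F(\alpha)\mapsto f(\alpha)$, for $\alpha$ ranging over all $k$-germs, is a one-to-one correspondence between the set of $n$-nests $\{F(\alpha)\}$ and the set of anchored Dyck words of length $n$.
   Context: A $k$-germ ($k\ge 2$) is a string $\alpha=a_{k-1}a_{k-2}\cdots a_1$ of nonnegative integers with $a_{k-1}\in\{0,1\}$ and $0\le a_{i-1}\le a_i+1$ for $1<i<k$. For $\alpha\neq 0^{k-1}$ let $i(\alpha)$ be the index of the rightmost nonzero entry of $\alpha$, and let the parent $\beta$ of $\alpha$ be the $k$-germ equal to $\alpha$ except that $b_{i(\alpha)}=a_{i(\alpha)}-1$; this makes the $k$-germs the nodes of a tree $\mathcal T_k$ rooted at $0^{k-1}$. The $n$-nest $F(\alpha)$ is a string of length $n=2k+1$ over $\{0,1,\dots,k\}$ defined recursively along $\mathcal T_k$: $F(0^{k-1})=0\,1\,2\cdots(k-1)\,k\,k\,(k-1)\cdots 2\,1$; for $\alpha\ne 0^{k-1}$ with parent $\beta$ and $i=i(\alpha)$, write $F(\beta)=W^i|M|Z^i$ where $W^i$, $Z^i$ are the leftmost and rightmost substrings of length $i$, let $c$ be the leftmost entry of $M$, and split $M=X|Y$ where $Y$ starts at the (leftmost) entry equal to $c+1$ in $M$; then $F(\alpha)=W^i|Y|X|Z^i$. In $F(\alpha)$ the entry $0$ appears once and each $j\in[1,k]$ appears exactly twice. The binary string $f(\alpha)$ is obtained from $F(\alpha)$ by replacing the first appearance of each integer by $0$ and the second appearance of each $j\in[1,k]$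 by $1$. A Dyck word of length $2k$ is a binary string with $k$ ones in which every prefix has at least as many $0$'s as $1$'s; an anchored Dyck word of length $2k+1$ is a $0$ followed by a Dyck word of length $2k$. -}

module Defs where

open import Data.Nat using (ℕ; zero; suc; _+_; _*_; _∸_; _≤_; _≡ᵇ_)
open import Data.Bool using (Bool; true; false; if_then_else_)
open import Data.List using (List; []; _∷_; _++_; length; take; drop; reverse; upTo; downFrom; map)
open import Data.Nat.ListAction using (sum)
open import Data.Bool.ListAction using (any)
open import Data.Empty using (⊥)
open import Data.List.Relation.Unary.Linked using (Linked)
open import Data.Product using (_×_; _,_)
open import Data.Unit using (⊤)
open import Relation.Binary.PropositionalEquality using (_≡_)

-- k-germs.  A k-germ a_{k-1} a_{k-2} ... a_1 is represented as the list
-- (a_{k-1} ∷ a_{k-2} ∷ ... ∷ a_1 ∷ []) of length k-1 (left to right).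

GermHead : List ℕ → Set
GermHead []      = ⊤
GermHead (x ∷ _) = x ≤ 1

GermStep : ℕ → ℕ → Set
GermStep x y = y ≤ suc x

IsGerm : ℕ → List ℕ → Set
IsGerm k α = (length α ≡ k ∸ 1) × GermHead α × Linked GermStep α

-- index of the rightmost nonzero entry, and the parent in the tree T_k.
-- Both are computed on the reversed list (a_1 ∷ a_2 ∷ ...), where
-- position p (1-based) holds a_p.

firstNZ : List ℕ → ℕ
firstNZ []            = 0
firstNZ (zero ∷ xs)   = suc (firstNZ xs)
firstNZ (suc _ ∷ _)   = 1

decFirstNZ : List ℕ → List ℕ
decFirstNZ []          = []
decFirstNZ (zero ∷ xs) = zero ∷ decFirstNZ xs
decFirstNZ (suc a ∷ xs) = a ∷ xs

idx : List ℕ → ℕ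
idx α = firstNZ (reverse α)

parent : List ℕ → List ℕ
parent α = reverse (decFirstNZ (reverse α))

rootNest : ℕ → List ℕ
rootNest k = upTo (suc k) ++ map suc (downFrom k)

splitAtVal : ℕ → List ℕ → List ℕ × List ℕ
splitAtVal t []       = [] , []
splitAtVal t (x ∷ xs) with x ≡ᵇ t
... | true  = [] , x ∷ xs
... | false with splitAtVal t xs
...   | (X , Y) = x ∷ X , Y

splitM : List ℕ → List ℕ × List ℕ
splitM []       = [] , []
splitM (c ∷ ms) = splitAtVal (suc c) (c ∷ ms)

-- given F(β) = W^i | M | Z^i, produce W^i | Y | X | Z^i
nestStep : ℕ → List ℕ → List ℕ
nestStep i s with splitM (take (length (drop i s) ∸ i) (drop i s))
... | (X , Y) = take i s ++ (Y ++ X) ++ drop (length (drop i s) ∸ i) (drop i s)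

-- recursion along the path from the root: the depth of α in T_k equals
-- the sum of its entries (each parent step decreases the sum by one).
nestGo : ℕ → ℕ → List ℕ → List ℕ
nestGo k zero    α = rootNest k
nestGo k (suc m) α = nestStep (idx α) (nestGo k m (parent α))

F : ℕ → List ℕ → List ℕ
F k α = nestGo k (sum α) α

-- binary string f(α): first appearance ↦ 0 (false), second ↦ 1 (true)

toBinGo : List ℕ → List ℕ → List Bool
toBinGo seen []       = []
toBinGo seen (x ∷ xs) =
  (if any (λ y → y ≡ᵇ x) seen then true else false) ∷ toBinGo (x ∷ seen) xs

toBin : List ℕ → List Bool
toBin = toBinGo []

f : ℕ → List ℕ → List Bool
f k α = toBin (F k α)

zeros : List Bool → ℕ
zeros []           = 0
zeros (false ∷ w)  = suc (zeros w)
zeros (true ∷ w)   = zeros w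

ones : List Bool → ℕ
ones []          = 0
ones (true ∷ w)  = suc (ones w)
ones (false ∷ w) = ones w

IsDyck : ℕ → List Bool → Set
IsDyck k w = (length w ≡ 2 * k) × (ones w ≡ k)
           × (∀ m → ones (take m w) ≤ zeros (take m w))

IsAnchoredDyck : ℕ → List Bool → Set
IsAnchoredDyck k []          = ⊥
IsAnchoredDyck k (true ∷ w)  = ⊥
IsAnchoredDyck k (false ∷ w) = IsDyck k w

{-# OPTIONS --safe #-}
-- Read the germ backwards, a₁ a₂ ⋯ a_{k-1}, and build a plane forest with distinct
-- labels from the single node for a_{k-1} outwards: entry aᵢ moves the last aᵢ
-- trees to the front and puts a new root, placed last, above the others (aᵢ never
-- exceeds the number of trees available, which is a_{i+1} + 1, exactly by the germ
-- condition). The rotation M = X | Y ↦ Y | X in the recursion for F(α) performs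
-- precisely this step, so F(α) is 0 followed by the depth-first serialisation of the
-- forest, each label written on entering and on leaving its node. As labels are
-- distinct, f(α) is 0 followed by the usual Dyck code of the unlabelled forest. Plane
-- forests with k nodes arise from exactly one germ each, by undoing the construction
-- at the last tree, and the Dyck code is a bijection between them and Dyck words
-- of length 2k.
module Submission where

open import Defs
open import Data.Bool using (Bool; true; false; T; if_then_else_)
open import Data.Bool.ListAction using (any)
open import Data.Bool.Properties using (T-≡)
open import Data.Empty using (⊥; ⊥-elim)
open import Data.List
  using (List; []; _∷_; _++_; _∷ʳ_; _ʳ++_; length; take; drop; reverse; replicate; upTo; downFrom; map)
open import Data.List.Properties
  using ( ++-assoc; ++-identityʳ; ++-ʳ++; ʳ++-defn; length-++; length-take; take++drop≡id
        ; unfold-reverse; reverse-++; reverse-involutive; reverse-injective; length-reverse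
        ; upTo-∷ʳ; length-upTo; length-map; length-downFrom; ∷-injective; ∷-injectiveʳ )
open import Data.List.Membership.Propositional using (_∈_; _∉_)
open import Data.List.Membership.Propositional.Properties using (∈-++⁺ˡ; ∈-++⁺ʳ; ∈-++⁻)
open import Data.List.Relation.Binary.Disjoint.Propositional using (Disjoint)
open import Data.List.Relation.Binary.Permutation.Propositional.Properties using (↭-reverse)
open import Data.List.Relation.Unary.All as All using (All; []; _∷_)
open import Data.List.Relation.Unary.All.Properties as All using ()
open import Data.List.Relation.Unary.AllPairs using ([]; _∷_)
open import Data.List.Relation.Unary.Any as Any using (here; there)
open import Data.List.Relation.Unary.Any.Properties using (any⁺; any⁻; reverse⁻)
open import Data.List.Relation.Unary.Linked using (Linked; []; [-]; _∷_)
open import Data.List.Relation.Unary.Unique.Propositional using (Unique)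
open import Data.List.Relation.Unary.Unique.Propositional.Properties as Unique using ()
open import Data.Nat using (ℕ; zero; suc; _+_; _*_; _∸_; _≤_; _<_; z≤n; s≤s; _≡ᵇ_)
open import Data.Nat.Properties
open import Data.Nat.ListAction using (sum)
open import Data.Nat.ListAction.Properties using (sum-↭)
open import Data.Product using (_×_; _,_; proj₁; proj₂; ∃-syntax)
open import Data.Sum using (_⊎_; inj₁; inj₂)
open import Data.Unit using (⊤; tt)
open import Function using (flip; _∘_)
open import Function.Bundles using (Equivalence)
open import Relation.Binary.PropositionalEquality

module _ {A : Set} where

  take-++ˡ : ∀ (xs ys : List A) → take (length xs) (xs ++ ys) ≡ xs
  take-++ˡ []       ys = refl
  take-++ˡ (x ∷ xs) ys = cong (x ∷_) (take-++ˡ xs ys)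

  drop-++ˡ : ∀ (xs ys : List A) → drop (length xs) (xs ++ ys) ≡ ys
  drop-++ˡ []       ys = refl
  drop-++ˡ (x ∷ xs) ys = drop-++ˡ xs ys

  take-++ : ∀ n (xs ys : List A) → take n (xs ++ ys) ≡ take n xs ++ take (n ∸ length xs) ys
  take-++ zero    []       ys = refl
  take-++ zero    (x ∷ xs) ys = refl
  take-++ (suc n) []       ys = refl
  take-++ (suc n) (x ∷ xs) ys = cong (x ∷_) (take-++ n xs ys)

  length-take-≤ : ∀ n (xs : List A) → n ≤ length xs → length (take n xs) ≡ n
  length-take-≤ n xs n≤ = trans (length-take n xs) (m≤n⇒m⊓n≡m n≤)

  take-suc-drop : ∀ n (xs : List A) {t rest} → drop n xs ≡ t ∷ rest → take (suc n) xs ≡ take n xs ∷ʳ t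
  take-suc-drop zero    (x ∷ xs) refl = refl
  take-suc-drop (suc n) (x ∷ xs) eq   = cong (x ∷_) (take-suc-drop n xs eq)

  drop-suc-drop : ∀ n (xs : List A) {t rest} → drop n xs ≡ t ∷ rest → drop (suc n) xs ≡ rest
  drop-suc-drop zero    (x ∷ xs) refl = refl
  drop-suc-drop (suc n) (x ∷ xs) eq   = drop-suc-drop n xs eq

  Linked-reverse : ∀ {R : A → A → Set} xs → Linked R xs → Linked (flip R) (reverse xs)
  Linked-reverse []       _ = []
  Linked-reverse (y ∷ xs) l = go xs [] l [-]
    where
    go : ∀ {R : A → A → Set} {y} xs acc → Linked R (y ∷ xs) → Linked (flip R) (y ∷ acc) →
         Linked (flip R) (xs ʳ++ (y ∷ acc))
    go []       acc _        l′ = l′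
    go (z ∷ zs) acc (r ∷ l) l′ = go zs (_ ∷ acc) l (r ∷ l′)

  Unique-++⁻ : ∀ (xs ys : List A) → Unique (xs ++ ys) → Unique xs × Unique ys × Disjoint xs ys
  Unique-++⁻ []       ys u       = [] , u , λ ()
  Unique-++⁻ (x ∷ xs) ys (x∉ ∷ u) with Unique-++⁻ xs ys u
  ... | uxs , uys , disj = All.++⁻ˡ xs x∉ ∷ uxs , uys , disj′
    where
    disj′ : Disjoint (x ∷ xs) ys
    disj′ (here refl , v∈ys) = All.lookup (All.++⁻ʳ xs x∉) v∈ys refl
    disj′ (there v∈xs , v∈ys) = disj (v∈xs , v∈ys)

  Unique-++-comm : ∀ (xs ys : List A) → Unique (xs ++ ys) → Unique (ys ++ xs)
  Unique-++-comm xs ys u with Unique-++⁻ xs ys u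
  ... | uxs , uys , disj = Unique.++⁺ uys uxs λ (v∈ys , v∈xs) → disj (v∈xs , v∈ys)

headOr0 : List ℕ → ℕ
headOr0 []      = 0
headOr0 (a ∷ _) = a

-- A k-germ a_{k-1} ⋯ a₂ a₁ read backwards as a₁ a₂ ⋯ a_{k-1}.
IsRevGerm : List ℕ → Set
IsRevGerm []      = ⊤
IsRevGerm (a ∷ r) = a ≤ suc (headOr0 r) × IsRevGerm r

IsRevGerm⇒Linked : ∀ r → IsRevGerm r → Linked (flip GermStep) (r ∷ʳ 0)
IsRevGerm⇒Linked []          _       = [-]
IsRevGerm⇒Linked (a ∷ [])    (p , _) = p ∷ [-]
IsRevGerm⇒Linked (a ∷ b ∷ r) (p , v) = p ∷ IsRevGerm⇒Linked (b ∷ r) v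

Linked⇒IsRevGerm : ∀ r → Linked (flip GermStep) (r ∷ʳ 0) → IsRevGerm r
Linked⇒IsRevGerm []          _       = tt
Linked⇒IsRevGerm (a ∷ [])    (p ∷ _) = p , tt
Linked⇒IsRevGerm (a ∷ b ∷ r) (p ∷ l) = p , Linked⇒IsRevGerm (b ∷ r) l

IsGerm⇒IsRevGerm : ∀ k α → IsGerm k α → IsRevGerm (reverse α)
IsGerm⇒IsRevGerm _ α (_ , h , l) =
  Linked⇒IsRevGerm (reverse α) (subst (Linked (flip GermStep)) (unfold-reverse 0 α) (Linked-reverse (0 ∷ α) (0∷ α h l)))
  where
  0∷ : ∀ α → GermHead α → Linked GermStep α → Linked GermStep (0 ∷ α)
  0∷ []      _ _ = [-]
  0∷ (_ ∷ _) h l = h ∷ l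

IsRevGerm⇒IsGerm : ∀ r → IsRevGerm r → IsGerm (suc (length r)) (reverse r)
IsRevGerm⇒IsGerm r v = length-reverse r , unpack (reverse r) linked
  where
  linked : Linked GermStep (0 ∷ reverse r)
  linked = subst (Linked GermStep) (reverse-++ r (0 ∷ [])) (Linked-reverse (r ∷ʳ 0) (IsRevGerm⇒Linked r v))
  unpack : ∀ α → Linked GermStep (0 ∷ α) → GermHead α × Linked GermStep α
  unpack []      _       = tt , []
  unpack (_ ∷ _) (h ∷ l) = h , l

-- Labelled forests

data Tree : Set where
  node : ℕ → List Tree → Tree

-- A forest lists its trees from right to left: serF (t ∷ ts) ends with t.
mutual
  ser : Tree → List ℕ
  ser (node m cs) = m ∷ serF cs ++ m ∷ []

  serF : List Tree → List ℕ
  serF []       = []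
  serF (t ∷ ts) = serF ts ++ ser t

serF-++ : ∀ ts us → serF (ts ++ us) ≡ serF us ++ serF ts
serF-++ []       us = sym (++-identityʳ (serF us))
serF-++ (t ∷ ts) us = begin
  serF (ts ++ us) ++ ser t      ≡⟨ cong (_++ ser t) (serF-++ ts us) ⟩
  (serF us ++ serF ts) ++ ser t ≡⟨ ++-assoc (serF us) (serF ts) (ser t) ⟩
  serF us ++ serF ts ++ ser t   ∎
  where open ≡-Reasoning

forest : ℕ → List ℕ → List Tree
forest m []      = node m [] ∷ []
forest m (a ∷ r) = node m (drop a (forest (suc m) r)) ∷ take a (forest (suc m) r)

length-forest : ∀ m r → IsRevGerm r → length (forest m r) ≡ suc (headOr0 r)
length-forest m []      _       = refl
length-forest m (a ∷ r) (a≤ , v) =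
  cong suc (length-take-≤ a (forest (suc m) r) (subst (a ≤_) (sym (length-forest (suc m) r v)) a≤))

-- The block M of the paper's decomposition F(β) = W | M | Z: the serialisation of
-- forest m (a ∷ r) without its final label m, which belongs to Z.
inner : ℕ → ℕ → List ℕ → List ℕ
inner m a r = serF (take a (forest (suc m) r)) ++ m ∷ serF (drop a (forest (suc m) r))

serF-forest-∷ : ∀ m a r → serF (forest m (a ∷ r)) ≡ inner m a r ++ m ∷ []
serF-forest-∷ m a r = sym (++-assoc Ts (m ∷ Ds) (m ∷ []))
  where
  Ts = serF (take a (forest (suc m) r))
  Ds = serF (drop a (forest (suc m) r))

Layered : ℕ → ℕ → List Tree → Set
Layered b L []                = ⊤
Layered b L (node m cs ∷ ts) = m ≡ b × All (L ≤_) (serF cs) × Layered (suc b) L ts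

Layered-take : ∀ n {b L} ts → Layered b L ts → Layered b L (take n ts)
Layered-take zero    ts                 _           = tt
Layered-take (suc n) []                 _           = tt
Layered-take (suc n) (node _ _ ∷ ts) (e , a , l) = e , a , Layered-take n ts l

Layered-drop : ∀ n {b L} ts → Layered b L ts → Layered (b + n) L (drop n ts)
Layered-drop zero    {b} ts l rewrite +-identityʳ b = l
Layered-drop (suc n) []                 _           = tt
Layered-drop (suc n) {b} (node _ _ ∷ ts) (_ , _ , l) rewrite +-suc b n = Layered-drop n ts l

Layered-weaken : ∀ {b L L′} ts → L′ ≤ L → Layered b L ts → Layered b L′ ts
Layered-weaken []                 _    _           = tt
Layered-weaken (node _ _ ∷ ts) L′≤L (e , a , l) =
  e , All.map (≤-trans L′≤L) a , Layered-weaken ts L′≤L l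

Layered-All : ∀ {P : ℕ → Set} {b L} ts → Layered b L ts →
  (∀ {x} → b ≤ x → x < b + length ts → P x) → (∀ {x} → L ≤ x → P x) → All P (serF ts)
Layered-All []                         _              _     _    = []
Layered-All {b = b} (node m cs ∷ ts) (refl , a , l) roots high =
  All.++⁺ (Layered-All ts l (λ {x} b<x x< → roots (<⇒≤ b<x) (subst (x <_) (sym (+-suc b (length ts))) x<)) high)
          (Pm ∷ All.++⁺ (All.map high a) (Pm ∷ []))
  where
  Pm = roots ≤-refl (subst (b <_) (sym (+-suc b _)) (s≤s (m≤m+n b _)))

Layered-forest : ∀ m r → IsRevGerm r → Layered m (m + length (forest m r)) (forest m r)
Layered-forest m []      _           = refl , [] , tt
Layered-forest m (a ∷ r) (a≤ , v) = refl , deep , Layered-weaken Ts bound≤ (Layered-take a S layered)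
  where
  S = forest (suc m) r
  Ts = take a S
  layered : Layered (suc m) (suc m + length S) S
  layered = Layered-forest (suc m) r v
  a≤S : a ≤ length S
  a≤S = subst (a ≤_) (sym (length-forest (suc m) r v)) a≤
  bound : m + suc (length Ts) ≡ suc m + a
  bound = trans (+-suc m _) (cong (λ n → suc (m + n)) (length-take-≤ a S a≤S))
  bound≤ : m + suc (length Ts) ≤ suc m + length S
  bound≤ = subst (_≤ suc m + length S) (sym bound) (+-monoʳ-≤ (suc m) a≤S)
  deep : All (m + suc (length Ts) ≤_) (serF (drop a S))
  deep rewrite bound = Layered-All (drop a S) (Layered-drop a S layered) (λ b≤x _ → b≤x)
                                   (≤-trans (+-monoʳ-≤ (suc m) a≤S))

Layered-drop-∷ : ∀ n {b L} ts → Layered b L ts → n < length ts →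
  ∃[ cs ] ∃[ rest ] drop n ts ≡ node (b + n) cs ∷ rest
Layered-drop-∷ zero    {b} (node _ cs ∷ ts) (refl , _ , _) _ =
  cs , ts , cong (λ x → node x cs ∷ ts) (sym (+-identityʳ b))
Layered-drop-∷ (suc n) {b} (node _ _ ∷ ts) (_ , _ , l) (s≤s n<) with Layered-drop-∷ n ts l n<
... | cs , rest , eq = cs , rest , trans eq (cong (λ x → node x cs ∷ rest) (sym (+-suc b n)))

serF-Layered-head : ∀ m {L} ts → Layered (suc m) L ts → ∀ ys →
  ∃[ zs ] serF ts ++ m ∷ ys ≡ (m + length ts) ∷ zs
serF-Layered-head m []                  _              ys = ys , cong (_∷ ys) (sym (+-identityʳ m))
serF-Layered-head m (node _ cs ∷ ts) (refl , _ , l) ys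
  with serF-Layered-head (suc m) ts l (serF cs ++ suc m ∷ m ∷ ys)
... | zs , eq = zs , (begin
  (serF ts ++ ser (node (suc m) cs)) ++ m ∷ ys  ≡⟨ ++-assoc (serF ts) _ _ ⟩
  serF ts ++ suc m ∷ (serF cs ++ suc m ∷ []) ++ m ∷ ys
      ≡⟨ cong (λ xs → serF ts ++ suc m ∷ xs) (++-assoc (serF cs) (suc m ∷ []) (m ∷ ys)) ⟩
  serF ts ++ suc m ∷ serF cs ++ suc m ∷ m ∷ ys  ≡⟨ eq ⟩
  (suc m + length ts) ∷ zs                       ≡⟨ cong (_∷ zs) (sym (+-suc m (length ts))) ⟩
  (m + suc (length ts)) ∷ zs                     ∎)
  where open ≡-Reasoning

nestStep-++ : ∀ W M Z → length Z ≡ length W →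
  nestStep (length W) (W ++ M ++ Z) ≡ W ++ (proj₂ (splitM M) ++ proj₁ (splitM M)) ++ Z
nestStep-++ W M Z e
  rewrite drop-++ˡ W (M ++ Z) | take-++ˡ W (M ++ Z) | length-++ M {Z} | e
        | m+n∸n≡m (length M) (length W) | take-++ˡ M Z | drop-++ˡ M Z = refl

splitAtVal-++ : ∀ v xs ys → All (_≢ v) xs → splitAtVal v (xs ++ v ∷ ys) ≡ (xs , v ∷ ys)
splitAtVal-++ v []       ys [] rewrite Equivalence.to T-≡ (≡⇒≡ᵇ v v refl) = refl
splitAtVal-++ v (x ∷ xs) ys (x≢v ∷ xs≢v) with x ≡ᵇ v in eq
... | true  = ⊥-elim (x≢v (≡ᵇ⇒≡ x v (subst T (sym eq) tt)))
... | false rewrite splitAtVal-++ v xs ys xs≢v = refl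

splitM-head : ∀ {xs c zs} → xs ≡ c ∷ zs → splitM xs ≡ splitAtVal (suc c) xs
splitM-head refl = refl

-- The first label of M is m + a and the first occurrence of m + a + 1 is the root of
-- the (a + 1)-st tree, so the rotation M = X | Y ↦ Y | X moves that tree to the front.
splitM-inner-≡ : ∀ m a r → IsRevGerm (suc a ∷ r) → ∃[ cs ] ∃[ rest ]
  drop a (forest (suc m) r) ≡ node (suc (m + a)) cs ∷ rest ×
  splitM (inner m a r) ≡ (serF (take a (forest (suc m) r)) ++ m ∷ serF rest , ser (node (suc (m + a)) cs))
splitM-inner-≡ m a r (a<′ , v) = cs , rest , drop≡ , split
  where
  S = forest (suc m) r
  L = suc m + length S
  layered : Layered (suc m) L S
  layered = Layered-forest (suc m) r v
  a< : a < length S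
  a< = subst (a <_) (sym (length-forest (suc m) r v)) a<′
  Ts = take a S
  length-Ts : length Ts ≡ a
  length-Ts = length-take-≤ a S (<⇒≤ a<)
  w = suc (m + a)
  cs = proj₁ (Layered-drop-∷ a S layered a<)
  rest = proj₁ (proj₂ (Layered-drop-∷ a S layered a<))
  drop≡ : drop a S ≡ node w cs ∷ rest
  drop≡ = proj₂ (proj₂ (Layered-drop-∷ a S layered a<))
  X = serF Ts ++ m ∷ serF rest
  inner≡ : inner m a r ≡ X ++ w ∷ serF cs ++ w ∷ []
  inner≡ = trans (cong (λ us → serF Ts ++ m ∷ serF us) drop≡) (sym (++-assoc (serF Ts) (m ∷ serF rest) _))
  head : ∃[ zs ] inner m a r ≡ (m + length Ts) ∷ zs
  head = serF-Layered-head m Ts (Layered-take a S layered) (serF (drop a S))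
  head≡ : inner m a r ≡ (m + a) ∷ proj₁ head
  head≡ = trans (proj₂ head) (cong (λ n → (m + n) ∷ proj₁ head) length-Ts)
  high : ∀ {x} → L ≤ x → x ≢ w
  high L≤x = >⇒≢ (<-≤-trans (+-monoʳ-< (suc m) a<) L≤x)
  w∉Ts : All (_≢ w) (serF Ts)
  w∉Ts = Layered-All Ts (Layered-take a S layered)
    (λ {x} _ x< → <⇒≢ (subst (x <_) (cong (suc m +_) length-Ts) x<)) high
  w∉rest : All (_≢ w) (serF rest)
  w∉rest = Layered-All rest (subst (Layered (suc m + suc a) L) (drop-suc-drop a S drop≡) (Layered-drop (suc a) S layered))
    (λ {x} b≤x _ → >⇒≢ (subst (_≤ x) (+-suc (suc m) a) b≤x)) high
  split : splitM (inner m a r) ≡ (X , ser (node w cs))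
  split = trans (splitM-head head≡)
                (trans (cong (splitAtVal w) inner≡)
                       (splitAtVal-++ w X _ (All.++⁺ w∉Ts (<⇒≢ (s≤s (m≤m+n m a)) ∷ w∉rest))))

splitM-inner : ∀ m a r → IsRevGerm (suc a ∷ r) →
  proj₂ (splitM (inner m a r)) ++ proj₁ (splitM (inner m a r)) ≡ inner m (suc a) r
splitM-inner m a r v with splitM-inner-≡ m a r v
... | cs , rest , drop≡ , split = begin
  proj₂ (splitM (inner m a r)) ++ proj₁ (splitM (inner m a r)) ≡⟨ cong (λ p → proj₂ p ++ proj₁ p) split ⟩
  ser t ++ serF Ts ++ m ∷ serF rest   ≡⟨ sym (++-assoc (ser t) (serF Ts) _) ⟩
  (ser t ++ serF Ts) ++ m ∷ serF rest ≡⟨ cong (λ xs → xs ++ m ∷ serF rest) (sym (serF-++ Ts (t ∷ []))) ⟩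
  serF (Ts ∷ʳ t) ++ m ∷ serF rest     ≡⟨ cong₂ (λ us vs → serF us ++ m ∷ serF vs)
                                               (sym (take-suc-drop a S drop≡)) (sym (drop-suc-drop a S drop≡)) ⟩
  inner m (suc a) r                    ∎
  where
  open ≡-Reasoning
  S = forest (suc m) r
  Ts = take a S
  t = node (suc (m + a)) cs

-- The nest of a germ

pad : ℕ → List ℕ → List ℕ
pad j r = reverse (replicate j 0 ++ r)

sum-reverse : ∀ xs → sum (reverse xs) ≡ sum xs
sum-reverse xs = sum-↭ (↭-reverse xs)

F-pad-[] : ∀ k j → F k (pad j []) ≡ rootNest k
F-pad-[] k j = cong (λ s → nestGo k s (pad j [])) (trans (sum-reverse (replicate j 0 ++ [])) (sum-zeros j))
  where
  sum-zeros : ∀ j → sum (replicate j 0 ++ []) ≡ 0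
  sum-zeros zero    = refl
  sum-zeros (suc j) = sum-zeros j

pad-zero : ∀ j r → pad j (0 ∷ r) ≡ pad (suc j) r
pad-zero j r = cong reverse (zeros-∷ j)
  where
  zeros-∷ : ∀ j → replicate j 0 ++ 0 ∷ r ≡ replicate (suc j) 0 ++ r
  zeros-∷ zero    = refl
  zeros-∷ (suc j) = cong (0 ∷_) (zeros-∷ j)

F-pad-suc : ∀ k j a r → F k (pad j (suc a ∷ r)) ≡ nestStep (suc j) (F k (pad j (a ∷ r)))
F-pad-suc k j a r = begin
  nestGo k (sum α) α                                       ≡⟨ cong (λ s → nestGo k s α) sum≡ ⟩
  nestStep (idx α) (nestGo k (sum (parent α)) (parent α)) ≡⟨ cong₂ nestStep idx≡ (cong (F k) parent≡) ⟩
  nestStep (suc j) (F k (pad j (a ∷ r)))                   ∎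
  where
  open ≡-Reasoning
  α = pad j (suc a ∷ r)
  firstNZ-zeros : ∀ j → firstNZ (replicate j 0 ++ suc a ∷ r) ≡ suc j
  firstNZ-zeros zero    = refl
  firstNZ-zeros (suc j) = cong suc (firstNZ-zeros j)
  decFirstNZ-zeros : ∀ j → decFirstNZ (replicate j 0 ++ suc a ∷ r) ≡ replicate j 0 ++ a ∷ r
  decFirstNZ-zeros zero    = refl
  decFirstNZ-zeros (suc j) = cong (0 ∷_) (decFirstNZ-zeros j)
  sum-zeros : ∀ j → sum (replicate j 0 ++ suc a ∷ r) ≡ suc (sum (replicate j 0 ++ a ∷ r))
  sum-zeros zero    = refl
  sum-zeros (suc j) = sum-zeros j
  idx≡ : idx α ≡ suc j
  idx≡ = trans (cong firstNZ (reverse-involutive _)) (firstNZ-zeros j)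
  parent≡ : parent α ≡ pad j (a ∷ r)
  parent≡ = cong reverse (trans (cong decFirstNZ (reverse-involutive _)) (decFirstNZ-zeros j))
  sum≡ : sum α ≡ suc (sum (parent α))
  sum≡ = begin
    sum α                                  ≡⟨ sum-reverse (replicate j 0 ++ suc a ∷ r) ⟩
    sum (replicate j 0 ++ suc a ∷ r)       ≡⟨ sum-zeros j ⟩
    suc (sum (replicate j 0 ++ a ∷ r))     ≡⟨ cong suc (sym (sum-reverse (replicate j 0 ++ a ∷ r))) ⟩
    suc (sum (pad j (a ∷ r)))              ≡⟨ cong (λ β → suc (sum β)) (sym parent≡) ⟩
    suc (sum (parent α))                   ∎

upTo-suc-++ : ∀ j xs → upTo (suc (suc j)) ++ xs ≡ upTo (suc j) ++ suc j ∷ xs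
upTo-suc-++ j xs = trans (cong (_++ xs) (sym (upTo-∷ʳ (suc j)))) (++-assoc (upTo (suc j)) _ xs)

nestOf : ℕ → List ℕ → List ℕ
nestOf j M = upTo (suc j) ++ M ++ map suc (downFrom j)

nestOf-rotate : ∀ j a r → IsRevGerm (suc a ∷ r) →
  nestStep (suc j) (nestOf j (inner (suc j) a r ++ suc j ∷ [])) ≡ nestOf j (inner (suc j) (suc a) r ++ suc j ∷ [])
nestOf-rotate j a r v = begin
  nestStep (suc j) (W ++ (M ++ suc j ∷ []) ++ Q)       ≡⟨ cong (λ xs → nestStep (suc j) (W ++ xs)) (++-assoc M _ Q) ⟩
  nestStep (suc j) (W ++ M ++ suc j ∷ Q)                ≡⟨ cong (λ i → nestStep i (W ++ M ++ suc j ∷ Q)) (sym (length-upTo (suc j))) ⟩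
  nestStep (length W) (W ++ M ++ suc j ∷ Q)             ≡⟨ nestStep-++ W M (suc j ∷ Q) length≡ ⟩
  W ++ (proj₂ (splitM M) ++ proj₁ (splitM M)) ++ suc j ∷ Q ≡⟨ cong (λ xs → W ++ xs ++ suc j ∷ Q) (splitM-inner (suc j) a r v) ⟩
  W ++ inner (suc j) (suc a) r ++ suc j ∷ Q              ≡⟨ cong (W ++_) (sym (++-assoc (inner (suc j) (suc a) r) _ Q)) ⟩
  nestOf j (inner (suc j) (suc a) r ++ suc j ∷ [])      ∎
  where
  open ≡-Reasoning
  W = upTo (suc j)
  M = inner (suc j) a r
  Q = map suc (downFrom j)
  length≡ : length (suc j ∷ Q) ≡ length W
  length≡ = trans (cong suc (trans (length-map suc (downFrom j)) (length-downFrom j))) (sym (length-upTo (suc j)))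

mutual
  F-pad : ∀ k j r → suc j + length r ≡ k → IsRevGerm r → F k (pad j r) ≡ nestOf j (serF (forest (suc j) r))
  F-pad k j []      e _ rewrite sym e | +-identityʳ j = trans (F-pad-[] (suc j) j) (upTo-suc-++ j _)
  F-pad k j (a ∷ r) e v = F-pad-∷ k j a r e v

  F-pad-∷ : ∀ k j a r → suc j + length (a ∷ r) ≡ k → IsRevGerm (a ∷ r) →
    F k (pad j (a ∷ r)) ≡ nestOf j (serF (forest (suc j) (a ∷ r)))
  F-pad-∷ k j zero r e (_ , v) = begin
    F k (pad j (0 ∷ r))                                   ≡⟨ cong (F k) (pad-zero j r) ⟩
    F k (pad (suc j) r)                                   ≡⟨ F-pad k (suc j) r (trans (cong suc (sym (+-suc j _))) e) v ⟩
    upTo (suc (suc j)) ++ serF S ++ suc j ∷ Q              ≡⟨ upTo-suc-++ j _ ⟩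
    upTo (suc j) ++ suc j ∷ serF S ++ suc j ∷ Q            ≡⟨ cong (λ xs → upTo (suc j) ++ suc j ∷ xs) (sym (++-assoc (serF S) _ Q)) ⟩
    nestOf j (serF (forest (suc j) (0 ∷ r)))              ∎
    where
    open ≡-Reasoning
    S = forest (suc (suc j)) r
    Q = map suc (downFrom j)
  F-pad-∷ k j (suc a) r e v = begin
    F k (pad j (suc a ∷ r))                                        ≡⟨ F-pad-suc k j a r ⟩
    nestStep (suc j) (F k (pad j (a ∷ r)))                         ≡⟨ cong (nestStep (suc j)) (F-pad-∷ k j a r e (weaken v)) ⟩
    nestStep (suc j) (nestOf j (serF (forest (suc j) (a ∷ r))))    ≡⟨ cong (nestStep (suc j) ∘ nestOf j) (serF-forest-∷ (suc j) a r) ⟩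
    nestStep (suc j) (nestOf j (inner (suc j) a r ++ suc j ∷ []))  ≡⟨ nestOf-rotate j a r v ⟩
    nestOf j (inner (suc j) (suc a) r ++ suc j ∷ [])              ≡⟨ cong (nestOf j) (sym (serF-forest-∷ (suc j) (suc a) r)) ⟩
    nestOf j (serF (forest (suc j) (suc a ∷ r)))                  ∎
    where
    open ≡-Reasoning
    weaken : IsRevGerm (suc a ∷ r) → IsRevGerm (a ∷ r)
    weaken (a< , v) = <⇒≤ a< , v

-- Plane forests and their codes

data PlaneTree : Set where
  pnode : List PlaneTree → PlaneTree

mutual
  shape : Tree → PlaneTree
  shape (node _ cs) = pnode (shapeF cs)

  shapeF : List Tree → List PlaneTree
  shapeF []       = []
  shapeF (t ∷ ts) = shape t ∷ shapeF ts

shapeF-take : ∀ n ts → shapeF (take n ts) ≡ take n (shapeF ts)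
shapeF-take zero    ts       = refl
shapeF-take (suc n) []       = refl
shapeF-take (suc n) (t ∷ ts) = cong (shape t ∷_) (shapeF-take n ts)

shapeF-drop : ∀ n ts → shapeF (drop n ts) ≡ drop n (shapeF ts)
shapeF-drop zero    ts       = refl
shapeF-drop (suc n) []       = refl
shapeF-drop (suc n) (t ∷ ts) = shapeF-drop n ts

planeForest : List ℕ → List PlaneTree
planeForest []      = pnode [] ∷ []
planeForest (a ∷ r) = pnode (drop a (planeForest r)) ∷ take a (planeForest r)

shapeF-forest : ∀ m r → shapeF (forest m r) ≡ planeForest r
shapeF-forest m []      = refl
shapeF-forest m (a ∷ r)
  rewrite shapeF-take a (forest (suc m) r) | shapeF-drop a (forest (suc m) r) | shapeF-forest (suc m) r = refl

mutual
  code : PlaneTree → List Bool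
  code (pnode cs) = false ∷ codeF cs ++ true ∷ []

  codeF : List PlaneTree → List Bool
  codeF []       = []
  codeF (t ∷ ts) = codeF ts ++ code t

mutual
  labels : Tree → List ℕ
  labels (node m cs) = m ∷ labelsF cs

  labelsF : List Tree → List ℕ
  labelsF []       = []
  labelsF (t ∷ ts) = labels t ++ labelsF ts

labelsF-++ : ∀ ts us → labelsF (ts ++ us) ≡ labelsF ts ++ labelsF us
labelsF-++ []       us = refl
labelsF-++ (t ∷ ts) us = trans (cong (labels t ++_) (labelsF-++ ts us)) (sym (++-assoc (labels t) (labelsF ts) (labelsF us)))

mutual
  ∈-ser⇒∈-labels : ∀ {x} t → x ∈ ser t → x ∈ labels t
  ∈-ser⇒∈-labels (node m cs) (here e) = here e
  ∈-ser⇒∈-labels (node m cs) (there x∈) with ∈-++⁻ (serF cs) x∈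
  ... | inj₁ x∈cs       = there (∈-serF⇒∈-labelsF cs x∈cs)
  ... | inj₂ (here e)   = here e

  ∈-serF⇒∈-labelsF : ∀ {x} ts → x ∈ serF ts → x ∈ labelsF ts
  ∈-serF⇒∈-labelsF (t ∷ ts) x∈ with ∈-++⁻ (serF ts) x∈
  ... | inj₁ x∈ts = ∈-++⁺ʳ (labels t) (∈-serF⇒∈-labelsF ts x∈ts)
  ... | inj₂ x∈t  = ∈-++⁺ˡ (∈-ser⇒∈-labels t x∈t)

labelsF-forest : ∀ m r → Unique (labelsF (forest m r)) × All (m ≤_) (labelsF (forest m r))
labelsF-forest m []      = ([] ∷ []) , (≤-refl ∷ [])
labelsF-forest m (a ∷ r) = (All.tabulate m∉ ∷ unique) , (≤-refl ∷ All.map (≤-trans (n≤1+n m)) (All.++⁺ bound-D bound-T))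
  where
  S = forest (suc m) r
  LT = labelsF (take a S)
  LD = labelsF (drop a S)
  split : labelsF S ≡ LT ++ LD
  split = trans (cong labelsF (sym (take++drop≡id a S))) (labelsF-++ (take a S) (drop a S))
  unique : Unique (LD ++ LT)
  unique = Unique-++-comm LT LD (subst Unique split (proj₁ (labelsF-forest (suc m) r)))
  bound : All (suc m ≤_) (LT ++ LD)
  bound = subst (All (suc m ≤_)) split (proj₂ (labelsF-forest (suc m) r))
  bound-T = All.++⁻ˡ LT bound
  bound-D = All.++⁻ʳ LT bound
  m∉ : ∀ {y} → y ∈ LD ++ LT → m ≢ y
  m∉ y∈ refl = 1+n≰n (All.lookup (All.++⁺ bound-D bound-T) y∈)

any-≡ᵇ-∈ : ∀ {x s} → x ∈ s → any (_≡ᵇ x) s ≡ true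
any-≡ᵇ-∈ {x} x∈s = Equivalence.to T-≡ (any⁺ _ (Any.map (λ { refl → ≡⇒≡ᵇ x x refl }) x∈s))

any-≡ᵇ-∉ : ∀ {x} s → x ∉ s → any (_≡ᵇ x) s ≡ false
any-≡ᵇ-∉ {x} s x∉s with any (_≡ᵇ x) s in eq
... | true  = ⊥-elim (x∉s (Any.map (λ {y} p → sym (≡ᵇ⇒≡ y x p)) (any⁻ _ s (subst T (sym eq) tt))))
... | false = refl

∈-ʳ++⁺ʳ : ∀ {x} xs {ys : List ℕ} → x ∈ ys → x ∈ xs ʳ++ ys
∈-ʳ++⁺ʳ xs x∈ys = subst (_ ∈_) (sym (ʳ++-defn xs)) (∈-++⁺ʳ (reverse xs) x∈ys)

∈-ʳ++⁻ : ∀ {x} xs {ys : List ℕ} → x ∈ xs ʳ++ ys → x ∈ xs ⊎ x ∈ ys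
∈-ʳ++⁻ xs x∈ with ∈-++⁻ (reverse xs) (subst (_ ∈_) (ʳ++-defn xs) x∈)
... | inj₁ x∈xs = inj₁ (reverse⁻ x∈xs)
... | inj₂ x∈ys = inj₂ x∈ys

mutual
  toBinGo-ser : ∀ t seen ys → Unique (labels t) → All (_∉ seen) (labels t) →
    toBinGo seen (ser t ++ ys) ≡ code (shape t) ++ toBinGo (ser t ʳ++ seen) ys
  toBinGo-ser (node m cs) seen ys (m∉cs ∷ unique) (m∉seen ∷ fresh) = begin
    toBinGo seen ((m ∷ serF cs ++ m ∷ []) ++ ys)
      ≡⟨ cong (λ xs → toBinGo seen (m ∷ xs)) (++-assoc (serF cs) (m ∷ []) ys) ⟩
    toBinGo seen (m ∷ serF cs ++ m ∷ ys)
      ≡⟨ cong (λ b → (if b then true else false) ∷ toBinGo (m ∷ seen) (serF cs ++ m ∷ ys)) (any-≡ᵇ-∉ seen m∉seen) ⟩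
    false ∷ toBinGo (m ∷ seen) (serF cs ++ m ∷ ys)
      ≡⟨ cong (false ∷_) (toBinGo-serF cs (m ∷ seen) (m ∷ ys) unique fresh′) ⟩
    false ∷ codeF (shapeF cs) ++ toBinGo seen′ (m ∷ ys)
      ≡⟨ cong (λ b → false ∷ codeF (shapeF cs) ++ (if b then true else false) ∷ toBinGo (m ∷ seen′) ys)
              (any-≡ᵇ-∈ (∈-ʳ++⁺ʳ (serF cs) (here refl))) ⟩
    false ∷ codeF (shapeF cs) ++ true ∷ toBinGo (m ∷ seen′) ys
      ≡⟨ cong (λ s → false ∷ codeF (shapeF cs) ++ true ∷ toBinGo s ys) (sym (++-ʳ++ (serF cs))) ⟩
    false ∷ codeF (shapeF cs) ++ true ∷ toBinGo ((serF cs ++ m ∷ []) ʳ++ (m ∷ seen)) ys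
      ≡⟨ cong (false ∷_) (sym (++-assoc (codeF (shapeF cs)) (true ∷ []) _)) ⟩
    code (shape (node m cs)) ++ toBinGo (ser (node m cs) ʳ++ seen) ys ∎
    where
    open ≡-Reasoning
    seen′ = serF cs ʳ++ (m ∷ seen)
    fresh′ : All (_∉ m ∷ seen) (labelsF cs)
    fresh′ = All.zipWith (λ { (m≢x , x∉seen) (here refl) → m≢x refl
                            ; (m≢x , x∉seen) (there x∈) → x∉seen x∈ }) (m∉cs , fresh)

  toBinGo-serF : ∀ ts seen ys → Unique (labelsF ts) → All (_∉ seen) (labelsF ts) →
    toBinGo seen (serF ts ++ ys) ≡ codeF (shapeF ts) ++ toBinGo (serF ts ʳ++ seen) ys
  toBinGo-serF []       seen ys _      _     = refl
  toBinGo-serF (t ∷ ts) seen ys unique fresh with Unique-++⁻ (labels t) (labelsF ts) unique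
  ... | unique-t , unique-ts , disjoint = begin
    toBinGo seen ((serF ts ++ ser t) ++ ys)
      ≡⟨ cong (toBinGo seen) (++-assoc (serF ts) (ser t) ys) ⟩
    toBinGo seen (serF ts ++ ser t ++ ys)
      ≡⟨ toBinGo-serF ts seen (ser t ++ ys) unique-ts (All.++⁻ʳ (labels t) fresh) ⟩
    codeF (shapeF ts) ++ toBinGo seen′ (ser t ++ ys)
      ≡⟨ cong (codeF (shapeF ts) ++_) (toBinGo-ser t seen′ ys unique-t fresh′) ⟩
    codeF (shapeF ts) ++ code (shape t) ++ toBinGo (ser t ʳ++ seen′) ys
      ≡⟨ sym (++-assoc (codeF (shapeF ts)) _ _) ⟩
    codeF (shapeF (t ∷ ts)) ++ toBinGo (ser t ʳ++ seen′) ys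
      ≡⟨ cong (λ s → codeF (shapeF (t ∷ ts)) ++ toBinGo s ys) (sym (++-ʳ++ (serF ts))) ⟩
    codeF (shapeF (t ∷ ts)) ++ toBinGo (serF (t ∷ ts) ʳ++ seen) ys ∎
    where
    open ≡-Reasoning
    seen′ = serF ts ʳ++ seen
    fresh′ : All (_∉ seen′) (labels t)
    fresh′ = All.tabulate λ {x} x∈t x∈seen′ → absurd x∈t (∈-ʳ++⁻ (serF ts) x∈seen′)
      where
      absurd : ∀ {x} → x ∈ labels t → x ∈ serF ts ⊎ x ∈ seen → ⊥
      absurd x∈t (inj₁ x∈ts)   = disjoint (x∈t , ∈-serF⇒∈-labelsF ts x∈ts)
      absurd x∈t (inj₂ x∈seen) = All.lookup (All.++⁻ˡ (labels t) fresh) x∈t x∈seen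

f-reverse : ∀ r → IsRevGerm r → f (suc (length r)) (reverse r) ≡ false ∷ codeF (planeForest r)
f-reverse r v = begin
  toBin (F (suc (length r)) (pad 0 r))                       ≡⟨ cong toBin (F-pad (suc (length r)) 0 r refl v) ⟩
  false ∷ toBinGo (0 ∷ []) (serF (forest 1 r) ++ [])         ≡⟨ cong (false ∷_) (toBinGo-serF (forest 1 r) (0 ∷ []) [] unique fresh) ⟩
  false ∷ codeF (shapeF (forest 1 r)) ++ []                  ≡⟨ cong (λ ts → false ∷ codeF ts ++ []) (shapeF-forest 1 r) ⟩
  false ∷ codeF (planeForest r) ++ []                        ≡⟨ cong (false ∷_) (++-identityʳ _) ⟩
  false ∷ codeF (planeForest r)                              ∎
  where
  open ≡-Reasoning
  unique = proj₁ (labelsF-forest 1 r)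
  fresh : All (_∉ 0 ∷ []) (labelsF (forest 1 r))
  fresh = All.map (λ { 1≤x (here refl) → 1+n≰n 1≤x }) (proj₂ (labelsF-forest 1 r))

mutual
  size : PlaneTree → ℕ
  size (pnode cs) = suc (sizeF cs)

  sizeF : List PlaneTree → ℕ
  sizeF []       = 0
  sizeF (t ∷ ts) = size t + sizeF ts

sizeF-++ : ∀ ts us → sizeF (ts ++ us) ≡ sizeF ts + sizeF us
sizeF-++ []       us = refl
sizeF-++ (t ∷ ts) us = trans (cong (size t +_) (sizeF-++ ts us)) (sym (+-assoc (size t) _ _))

ones-++ : ∀ u v → ones (u ++ v) ≡ ones u + ones v
ones-++ []          v = refl
ones-++ (true ∷ u)  v = cong suc (ones-++ u v)
ones-++ (false ∷ u) v = ones-++ u v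

zeros-++ : ∀ u v → zeros (u ++ v) ≡ zeros u + zeros v
zeros-++ []          v = refl
zeros-++ (true ∷ u)  v = zeros-++ u v
zeros-++ (false ∷ u) v = cong suc (zeros-++ u v)

length≡ones+zeros : ∀ w → length w ≡ ones w + zeros w
length≡ones+zeros []          = refl
length≡ones+zeros (true ∷ w)  = cong suc (length≡ones+zeros w)
length≡ones+zeros (false ∷ w) = trans (cong suc (length≡ones+zeros w)) (sym (+-suc (ones w) (zeros w)))

mutual
  ones-code : ∀ t → ones (code t) ≡ size t
  ones-code (pnode cs) = trans (ones-++ (codeF cs) (true ∷ [])) (trans (+-comm _ 1) (cong suc (ones-codeF cs)))

  ones-codeF : ∀ ts → ones (codeF ts) ≡ sizeF ts
  ones-codeF []       = refl
  ones-codeF (t ∷ ts) = trans (ones-++ (codeF ts) (code t))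
                              (trans (cong₂ _+_ (ones-codeF ts) (ones-code t)) (+-comm (sizeF ts) (size t)))

mutual
  zeros-code : ∀ t → zeros (code t) ≡ size t
  zeros-code (pnode cs) = cong suc (trans (zeros-++ (codeF cs) (true ∷ [])) (trans (+-identityʳ _) (zeros-codeF cs)))

  zeros-codeF : ∀ ts → zeros (codeF ts) ≡ sizeF ts
  zeros-codeF []       = refl
  zeros-codeF (t ∷ ts) = trans (zeros-++ (codeF ts) (code t))
                               (trans (cong₂ _+_ (zeros-codeF ts) (zeros-code t)) (+-comm (sizeF ts) (size t)))

PrefixBalanced : List Bool → Set
PrefixBalanced w = ∀ m → ones (take m w) ≤ zeros (take m w)

PrefixBalanced-++ : ∀ u v → PrefixBalanced u → PrefixBalanced v → PrefixBalanced (u ++ v)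
PrefixBalanced-++ u v pu pv m
  rewrite take-++ m u v | ones-++ (take m u) (take (m ∸ length u) v) | zeros-++ (take m u) (take (m ∸ length u) v)
  = +-mono-≤ (pu m) (pv (m ∸ length u))

ones-take-true : ∀ n → ones (take n (true ∷ [])) ≤ 1
ones-take-true zero          = z≤n
ones-take-true (suc zero)    = ≤-refl
ones-take-true (suc (suc n)) = ≤-refl

PrefixBalanced-wrap : ∀ w → PrefixBalanced w → PrefixBalanced (false ∷ w ++ true ∷ [])
PrefixBalanced-wrap w pw zero = z≤n
PrefixBalanced-wrap w pw (suc m)
  rewrite take-++ m w (true ∷ []) | ones-++ (take m w) (take (m ∸ length w) (true ∷ []))
        | zeros-++ (take m w) (take (m ∸ length w) (true ∷ []))
  = ≤-trans (+-mono-≤ (pw m) (ones-take-true (m ∸ length w)))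
            (≤-trans (≤-reflexive (+-comm (zeros (take m w)) 1)) (s≤s (m≤m+n _ _)))

mutual
  PrefixBalanced-code : ∀ t → PrefixBalanced (code t)
  PrefixBalanced-code (pnode cs) = PrefixBalanced-wrap (codeF cs) (PrefixBalanced-codeF cs)

  PrefixBalanced-codeF : ∀ ts → PrefixBalanced (codeF ts)
  PrefixBalanced-codeF []       zero    = z≤n
  PrefixBalanced-codeF []       (suc _) = z≤n
  PrefixBalanced-codeF (t ∷ ts)   =
    PrefixBalanced-++ (codeF ts) (code t) (PrefixBalanced-codeF ts) (PrefixBalanced-code t)

codeF-IsDyck : ∀ ts → IsDyck (sizeF ts) (codeF ts)
codeF-IsDyck ts = length≡ , ones-codeF ts , PrefixBalanced-codeF ts
  where
  length≡ : length (codeF ts) ≡ 2 * sizeF ts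
  length≡ rewrite length≡ones+zeros (codeF ts) | ones-codeF ts | zeros-codeF ts | +-identityʳ (sizeF ts) = refl

-- c is the forest read so far at the current depth, st the unfinished forests of
-- the enclosing levels; an unmatched 1 is skipped.
parseGo : List (List PlaneTree) → List PlaneTree → List Bool → List PlaneTree
parseGo st       c []          = c
parseGo st       c (false ∷ w) = parseGo (c ∷ st) [] w
parseGo []       c (true ∷ w)  = parseGo [] c w
parseGo (p ∷ st) c (true ∷ w)  = parseGo st (pnode c ∷ p) w

parse : List Bool → List PlaneTree
parse = parseGo [] []

mutual
  parseGo-code : ∀ t st c w → parseGo st c (code t ++ w) ≡ parseGo st (t ∷ c) w
  parseGo-code (pnode cs) st c w = begin
    parseGo (c ∷ st) [] ((codeF cs ++ true ∷ []) ++ w) ≡⟨ cong (parseGo (c ∷ st) []) (++-assoc (codeF cs) (true ∷ []) w) ⟩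
    parseGo (c ∷ st) [] (codeF cs ++ true ∷ w)         ≡⟨ parseGo-codeF cs (c ∷ st) [] (true ∷ w) ⟩
    parseGo st (pnode (cs ++ []) ∷ c) w                 ≡⟨ cong (λ ds → parseGo st (pnode ds ∷ c) w) (++-identityʳ cs) ⟩
    parseGo st (pnode cs ∷ c) w                         ∎
    where open ≡-Reasoning

  parseGo-codeF : ∀ ts st c w → parseGo st c (codeF ts ++ w) ≡ parseGo st (ts ++ c) w
  parseGo-codeF []       st c w = refl
  parseGo-codeF (t ∷ ts) st c w = begin
    parseGo st c ((codeF ts ++ code t) ++ w) ≡⟨ cong (parseGo st c) (++-assoc (codeF ts) (code t) w) ⟩
    parseGo st c (codeF ts ++ code t ++ w)   ≡⟨ parseGo-codeF ts st c (code t ++ w) ⟩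
    parseGo st (ts ++ c) (code t ++ w)       ≡⟨ parseGo-code t st (ts ++ c) w ⟩
    parseGo st (t ∷ ts ++ c) w               ∎
    where open ≡-Reasoning

parse-codeF : ∀ ts → parse (codeF ts) ≡ ts
parse-codeF ts = begin
  parseGo [] [] (codeF ts)       ≡⟨ cong (parseGo [] []) (sym (++-identityʳ (codeF ts))) ⟩
  parseGo [] [] (codeF ts ++ []) ≡⟨ parseGo-codeF ts [] [] [] ⟩
  ts ++ []                       ≡⟨ ++-identityʳ ts ⟩
  ts                             ∎
  where open ≡-Reasoning

codeF-injective : ∀ ts us → codeF ts ≡ codeF us → ts ≡ us
codeF-injective ts us eq = trans (sym (parse-codeF ts)) (trans (cong parse eq) (parse-codeF us))

stackCode : List (List PlaneTree) → List PlaneTree → List Bool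
stackCode []       c = codeF c
stackCode (p ∷ st) c = stackCode st p ++ false ∷ codeF c

stackCode-∷ : ∀ st c t → stackCode st (t ∷ c) ≡ stackCode st c ++ code t
stackCode-∷ []       c t = refl
stackCode-∷ (p ∷ st) c t = sym (++-assoc (stackCode st p) (false ∷ codeF c) (code t))

Closes : ℕ → List Bool → Set
Closes h w = (∀ j → ones (take j w) ≤ h + zeros (take j w)) × ones w ≡ h + zeros w

codeF-parseGo : ∀ st c w → Closes (length st) w → codeF (parseGo st c w) ≡ stackCode st c ++ w
codeF-parseGo []       c []          _           = sym (++-identityʳ (codeF c))
codeF-parseGo (p ∷ st) c []          (_ , ())
codeF-parseGo st       c (false ∷ w) (pre , all) = begin
  codeF (parseGo (c ∷ st) [] w)      ≡⟨ codeF-parseGo (c ∷ st) [] w (pre′ , trans all (+-suc (length st) (zeros w))) ⟩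
  (stackCode st c ++ false ∷ []) ++ w ≡⟨ ++-assoc (stackCode st c) (false ∷ []) w ⟩
  stackCode st c ++ false ∷ w         ∎
  where
  open ≡-Reasoning
  pre′ : ∀ j → ones (take j w) ≤ suc (length st) + zeros (take j w)
  pre′ j = subst (ones (take j w) ≤_) (+-suc (length st) _) (pre (suc j))
codeF-parseGo []       c (true ∷ w)  (pre , _) with pre 1
... | ()
codeF-parseGo (p ∷ st) c (true ∷ w)  (pre , all) = begin
  codeF (parseGo st (pnode c ∷ p) w)                     ≡⟨ codeF-parseGo st (pnode c ∷ p) w (≤-pred ∘ pre ∘ suc , suc-injective all) ⟩
  stackCode st (pnode c ∷ p) ++ w                        ≡⟨ cong (_++ w) (stackCode-∷ st p (pnode c)) ⟩
  (stackCode st p ++ false ∷ codeF c ++ true ∷ []) ++ w  ≡⟨ ++-assoc (stackCode st p) _ w ⟩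
  stackCode st p ++ false ∷ (codeF c ++ true ∷ []) ++ w  ≡⟨ cong (λ u → stackCode st p ++ false ∷ u) (++-assoc (codeF c) (true ∷ []) w) ⟩
  stackCode st p ++ false ∷ codeF c ++ true ∷ w          ≡⟨ sym (++-assoc (stackCode st p) (false ∷ codeF c) (true ∷ w)) ⟩
  stackCode (p ∷ st) c ++ true ∷ w                       ∎
  where open ≡-Reasoning

codeF-parse : ∀ k d → IsDyck k d → codeF (parse d) ≡ d × sizeF (parse d) ≡ k
codeF-parse k d (length≡ , ones≡ , pre) = codeF≡ , trans (sym (ones-codeF (parse d))) (trans (cong ones codeF≡) ones≡)
  where
  zeros≡ : zeros d ≡ k
  zeros≡ = +-cancelˡ-≡ k (zeros d) k (begin
    k + zeros d      ≡⟨ cong (_+ zeros d) (sym ones≡) ⟩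
    ones d + zeros d ≡⟨ sym (length≡ones+zeros d) ⟩
    length d         ≡⟨ length≡ ⟩
    k + (k + 0)      ≡⟨ cong (k +_) (+-identityʳ k) ⟩
    k + k            ∎)
    where open ≡-Reasoning
  codeF≡ : codeF (parse d) ≡ d
  codeF≡ = codeF-parseGo [] [] d (pre , trans ones≡ (sym zeros≡))

-- Germs and anchored Dyck words

length-planeForest : ∀ r → IsRevGerm r → length (planeForest r) ≡ suc (headOr0 r)
length-planeForest []      _        = refl
length-planeForest (a ∷ r) (a≤ , v) =
  cong suc (length-take-≤ a (planeForest r) (subst (a ≤_) (sym (length-planeForest r v)) a≤))

sizeF-planeForest : ∀ r → sizeF (planeForest r) ≡ suc (length r)
sizeF-planeForest []      = refl
sizeF-planeForest (a ∷ r) = begin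
  suc (sizeF (drop a P)) + sizeF (take a P) ≡⟨ cong suc (+-comm (sizeF (drop a P)) _) ⟩
  suc (sizeF (take a P) + sizeF (drop a P)) ≡⟨ cong suc (sym (sizeF-++ (take a P) (drop a P))) ⟩
  suc (sizeF (take a P ++ drop a P))        ≡⟨ cong (suc ∘ sizeF) (take++drop≡id a P) ⟩
  suc (sizeF P)                             ≡⟨ cong suc (sizeF-planeForest r) ⟩
  suc (suc (length r))                      ∎
  where
  open ≡-Reasoning
  P = planeForest r

planeForest-injective : ∀ r s → length r ≡ length s → IsRevGerm r → IsRevGerm s →
  planeForest r ≡ planeForest s → r ≡ s
planeForest-injective []      []      _ _ _ _ = refl
planeForest-injective (a ∷ r) (b ∷ s) length≡ (a≤ , v) (b≤ , w) eq
  with ∷-injective eq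
... | root≡ , take≡ = cong₂ _∷_ a≡b (planeForest-injective r s (suc-injective length≡) v w P≡Q)
  where
  P = planeForest r
  Q = planeForest s
  a≡b : a ≡ b
  a≡b = trans (sym (length-take-≤ a P (subst (a ≤_) (sym (length-planeForest r v)) a≤)))
              (trans (cong length take≡) (length-take-≤ b Q (subst (b ≤_) (sym (length-planeForest s w)) b≤)))
  drop≡ : drop a P ≡ drop b Q
  drop≡ = cong (λ { (pnode cs) → cs }) root≡
  P≡Q : P ≡ Q
  P≡Q = trans (sym (take++drop≡id a P)) (trans (cong₂ _++_ take≡ drop≡) (take++drop≡id b Q))

sizeF≡0 : ∀ ts → sizeF ts ≡ 0 → ts ≡ []
sizeF≡0 []      _ = refl
sizeF≡0 (pnode _ ∷ _) ()

-- pnode D ∷ T is the plane forest of a ∷ r exactly when a = length T and T ++ D is that of r.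
planeForest-surjective : ∀ n ts → sizeF ts ≡ suc n → ∃[ r ] length r ≡ n × IsRevGerm r × planeForest r ≡ ts
planeForest-surjective n       []               ()
planeForest-surjective zero    (pnode D ∷ T) eq
  with sizeF≡0 D (m+n≡0⇒m≡0 (sizeF D) (suc-injective eq)) | sizeF≡0 T (m+n≡0⇒n≡0 (sizeF D) (suc-injective eq))
... | refl | refl = [] , refl , tt , refl
planeForest-surjective (suc n) (pnode D ∷ T) eq
  with planeForest-surjective n (T ++ D) (trans (sizeF-++ T D) (trans (+-comm (sizeF T) (sizeF D)) (suc-injective eq)))
... | r , length≡ , v , P≡ = length T ∷ r , cong suc length≡ , (T≤ , v) , P∷≡
  where
  T≤ : length T ≤ suc (headOr0 r)
  T≤ = subst (length T ≤_) (trans (trans (sym (length-++ T)) (cong length (sym P≡))) (length-planeForest r v))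
             (m≤m+n (length T) (length D))
  P∷≡ : planeForest (length T ∷ r) ≡ pnode D ∷ T
  P∷≡ rewrite P≡ | drop-++ˡ T D | take-++ˡ T D = refl

f-germ : ∀ n α → IsGerm (suc n) α → f (suc n) α ≡ false ∷ codeF (planeForest (reverse α))
f-germ n α g@(length≡ , _) = begin
  f (suc n) α                          ≡⟨ cong (λ k → f (suc k) α) (sym (trans (length-reverse α) length≡)) ⟩
  f (suc (length (reverse α))) α       ≡⟨ cong (f _) (sym (reverse-involutive α)) ⟩
  f (suc (length (reverse α))) (reverse (reverse α)) ≡⟨ f-reverse (reverse α) (IsGerm⇒IsRevGerm (suc n) α g) ⟩
  false ∷ codeF (planeForest (reverse α)) ∎
  where open ≡-Reasoning

f-IsAnchoredDyck : ∀ n α → IsGerm (suc n) α → IsAnchoredDyck (suc n) (f (suc n) α)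
f-IsAnchoredDyck n α g@(length≡ , _) rewrite f-germ n α g =
  subst (λ k → IsDyck k (codeF P)) (trans (sizeF-planeForest (reverse α)) (cong suc (trans (length-reverse α) length≡)))
        (codeF-IsDyck P)
  where P = planeForest (reverse α)

f-injective : ∀ n α β → IsGerm (suc n) α → IsGerm (suc n) β → f (suc n) α ≡ f (suc n) β → α ≡ β
f-injective n α β gα gβ eq = reverse-injective
  (planeForest-injective (reverse α) (reverse β) length≡ (IsGerm⇒IsRevGerm (suc n) α gα) (IsGerm⇒IsRevGerm (suc n) β gβ)
    (codeF-injective _ _ (∷-injectiveʳ (trans (sym (f-germ n α gα)) (trans eq (f-germ n β gβ))))))
  where
  length≡ : length (reverse α) ≡ length (reverse β)
  length≡ = trans (length-reverse α) (trans (proj₁ gα) (sym (trans (length-reverse β) (proj₁ gβ))))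

f-surjective : ∀ n w → IsAnchoredDyck (suc n) w → ∃[ α ] IsGerm (suc n) α × f (suc n) α ≡ w
f-surjective n (false ∷ d) dyck with codeF-parse (suc n) d dyck
... | codeF≡ , sizeF≡ with planeForest-surjective n (parse d) sizeF≡
... | r , refl , v , P≡ = reverse r , IsRevGerm⇒IsGerm r v , (begin
  f (suc (length r)) (reverse r)   ≡⟨ f-reverse r v ⟩
  false ∷ codeF (planeForest r)    ≡⟨ cong (λ ts → false ∷ codeF ts) P≡ ⟩
  false ∷ codeF (parse d)          ≡⟨ cong (false ∷_) codeF≡ ⟩
  false ∷ d                        ∎)
  where open ≡-Reasoning

corollary4 : (k : ℕ) → 2 ≤ k →
    ((α : List ℕ) → IsGerm k α → IsAnchoredDyck k (f k α))
    × ((α β : List ℕ) → IsGerm k α → IsGerm k β → f k α ≡ f k β → F k α ≡ F k β)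
    × ((w : List Bool) → IsAnchoredDyck k w → ∃[ α ] (IsGerm k α × f k α ≡ w))
corollary4 (suc n) _ =
  f-IsAnchoredDyck n ,
  (λ α β gα gβ eq → cong (F (suc n)) (f-injective n α β gα gβ eq)) ,
  f-surjective n
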